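{- Let $\mathcal{V}_\Sigma=\sum_{i=1}^r\Big(\sum_{j=1}^p\lambda_{\alpha_{i,j}}L_{\alpha_{i,j}}+\lambda_{\alpha_i}L_{\alpha_i}\Big)+\sum_{i=1}^s\lambda_{\beta_i}L_{\beta_i}$ with $\lambda_{\beta_i}=\lambda_{\alpha_{i,j}}=-\frac{p-2}{p}$ and $\lambda_{\alpha_i}=-2\frac{p-2}{p}$. Then, for the intersection pairing in the fibre of $\mathfrak{F}_p$ above $(\pi)$, $\mathcal{V}_\Sigma\cdot\mathcal{V}_\Sigma=(p-3)(-p)\left(\frac{p-2}{p}\right)^2$.
   Context: $p>3$ prime, $\pi=1-\zeta_p$. $\mathfrak{F}_p$ is McCallum's regular model over $\operatorname{Spec}\mathbb{Z}[\zeta_p]$ of the Fermat curve $X^p+Y^p=Z^p$. Its fibre above $(\pi)$ consists (geometrically) of genus-0 components $L$ (multiplicity $p$, self-intersection $-1$); $L_x,L_y,L_z$ (multiplicity 1, self-intersection $-p$); $L_{\beta_1},\dots,L_{\beta_s}$ (multiplicity 1, self-intersection $-p$); $L_{\alpha_1},\dots,L_{\alpha_r}$ (multiplicity 2, self-intersection $-p$); and for each $i$, $L_{\alpha_{i,1}},\dots,L_{\alpha_{i,p}}$ (multiplicity 1, self-intersection $-2$) each meeting $L_{\alpha_i}$ transversally once. $L$ meets each of $L_x,L_y,L_z,L_{\alpha_i},L_{\beta_j}$ once, and there are no other intersections between distinct components. One has $2r+s=p-3$ (the $\alpha_i\in\mathbb{F}_p\setminus\{0,1\}$ are the double roots and the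 $\beta_j$ the roots outside $\mathbb{F}_p$ of $\phi(X,-1)$, $\phi(X,Y)=((X+Y)^p-X^p-Y^p)/p$, a polynomial of degree $p-1$ with simple roots $0,1$). -}

module Defs where

open import Data.Nat as ℕ using (ℕ; NonZero)
open import Data.Integer using (+_)
open import Data.Fin using (Fin)
open import Data.Fin.Properties using () renaming (_≟_ to _≟F_)
open import Data.Bool using (Bool; true; false; _∧_; if_then_else_)
open import Relation.Nullary.Decidable using (⌊_⌋)
open import Data.List using (List; _∷_; []; _++_; map; concatMap; foldr; allFin)
open import Data.Rational using (ℚ; 0ℚ; 1ℚ; -_; _+_; _*_; _/_)

-- Geometric components of the fibre of McCallum's model 𝔉_p above (π),
-- for parameters p, r, s.
data Comp (p r s : ℕ) : Set where
  L Lx Ly Lz : Comp p r s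
  Lβ  : Fin s → Comp p r s
  Lα  : Fin r → Comp p r s
  Lαj : Fin r → Fin p → Comp p r s

allComps : (p r s : ℕ) → List (Comp p r s)
allComps p r s =
  L ∷ Lx ∷ Ly ∷ Lz ∷
  (map Lβ (allFin s) ++ map Lα (allFin r)
    ++ concatMap (λ i → map (Lαj i) (allFin p)) (allFin r))

private
  eqF : ∀ {n} → Fin n → Fin n → Bool
  eqF i j = ⌊ i ≟F j ⌋

  ind : Bool → ℚ → ℚ
  ind b q = if b then q else 0ℚ

ℚof : ℕ → ℚ
ℚof n = (+ n) / 1

ι : ∀ {p r s} → Comp p r s → Comp p r s → ℚ
ι L L = - 1ℚ
ι {p} Lx Lx = - ℚof p
ι {p} Ly Ly = - ℚof p
ι {p} Lz Lz = - ℚof p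
ι {p} (Lβ i) (Lβ j) = ind (eqF i j) (- ℚof p)
ι {p} (Lα i) (Lα j) = ind (eqF i j) (- ℚof p)
ι (Lαj i k) (Lαj i' k') = ind (eqF i i' ∧ eqF k k') (- ℚof 2)
ι L Lx = 1ℚ
ι L Ly = 1ℚ
ι L Lz = 1ℚ
ι L (Lβ _) = 1ℚ
ι L (Lα _) = 1ℚ
ι Lx L = 1ℚ
ι Ly L = 1ℚ
ι Lz L = 1ℚ
ι (Lβ _) L = 1ℚ
ι (Lα _) L = 1ℚ
ι (Lα i) (Lαj i' _) = ind (eqF i i') 1ℚ
ι (Lαj i' _) (Lα i) = ind (eqF i i') 1ℚ
ι _ _ = 0ℚ

Σ : ∀ {A : Set} → List A → (A → ℚ) → ℚ
Σ xs f = foldr (λ x acc → f x + acc) 0ℚ xs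

Divisor : (p r s : ℕ) → Set
Divisor p r s = Comp p r s → ℚ

_·_ : ∀ {p r s} → Divisor p r s → Divisor p r s → ℚ
_·_ {p} {r} {s} D E =
  Σ (allComps p r s) λ c → Σ (allComps p r s) λ c' → D c * E c' * ι c c'

VΣ : (p r s : ℕ) .{{_ : NonZero p}} → Divisor p r s
VΣ p r s L = 0ℚ
VΣ p r s Lx = 0ℚ
VΣ p r s Ly = 0ℚ
VΣ p r s Lz = 0ℚ
VΣ p r s (Lβ _) = - ((+ (p ℕ.∸ 2)) / p)
VΣ p r s (Lα _) = - (ℚof 2 * ((+ (p ℕ.∸ 2)) / p))
VΣ p r s (Lαj _ _) = - ((+ (p ℕ.∸ 2)) / p)

module Submission where

-- Write c = (p-2)/p.  The pairing is bilinear, so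
--   𝒱_Σ · 𝒱_Σ = Σ_C λ_C (𝒱_Σ · C),
-- and 𝒱_Σ is supported on the components L_β, L_α, L_{α_{i,j}}.  Its
-- intersection with each of them is read off from the configuration:
--   𝒱_Σ · L_{β_j}      = λ_β (-p)                  = c p,
--   𝒱_Σ · L_{α_i}      = λ_α (-p) + p λ_{α_{i,j}}   = c p,
--   𝒱_Σ · L_{α_{i,j}}  = λ_α + λ_{α_{i,j}} (-2)     = 0.
-- Hence 𝒱_Σ · 𝒱_Σ = s (-c)(c p) + r (-2c)(c p) = -(2r + s) p c², and
-- 2r + s = p - 3 gives the theorem.

open import Defs
open import Data.Nat using (ℕ; NonZero; _<_; _+_; _*_; _∸_)
import Data.Nat as ℕ
import Data.Nat.Properties as ℕP
open import Data.Nat.Primality using (Prime)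
open import Data.Integer using (+_) renaming (_+_ to _+ℤ_)
open import Data.Rational using (ℚ; -_; 0ℚ; 1ℚ; mkℚ)
  renaming (_*_ to _*ℚ_; _/_ to _/ℚ_; _+_ to _+ℚ_)
open import Data.Rational.Properties
  using (normalize-coprime; +-identityˡ; +-identityʳ; +-assoc; *-assoc; *-zeroˡ; *-zeroʳ; *-distribˡ-+)
open import Data.Rational.Solver using (module +-*-Solver)
import Data.Integer.Properties as ℤP
import Data.Nat.Coprimality as Coprime
open import Data.Fin using (Fin; zero; suc)
open import Data.Fin.Properties using (suc-injective) renaming (_≟_ to _≟F_)
open import Data.Bool using (_∧_; if_then_else_)
open import Relation.Nullary.Decidable using (⌊_⌋; yes; no)
open import Data.Empty using (⊥-elim)
open import Data.List using (List; _∷_; []; _++_; map; concatMap; tabulate; allFin)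
open import Relation.Binary.PropositionalEquality
  using (_≡_; _≢_; refl; sym; trans; cong; cong₂; module ≡-Reasoning)

ℚof-suc : ∀ n → ℚof (ℕ.suc n) ≡ 1ℚ +ℚ ℚof n
ℚof-suc n = sym (begin
  1ℚ +ℚ ℚof n               ≡⟨ cong (1ℚ +ℚ_) (normalize-coprime coprime) ⟩
  1ℚ +ℚ mkℚ (+ n) 0 coprime ≡⟨ cong (λ m → (+ 1 +ℤ m) /ℚ 1) (ℤP.*-identityʳ (+ n)) ⟩
  ℚof (ℕ.suc n)             ∎)
  where
  open ≡-Reasoning
  coprime = Coprime.sym (Coprime.1-coprimeTo n)

ℚof-+ : ∀ m n → ℚof (m + n) ≡ ℚof m +ℚ ℚof n
ℚof-+ ℕ.zero    n = sym (+-identityˡ (ℚof n))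
ℚof-+ (ℕ.suc m) n = begin
  ℚof (ℕ.suc (m + n))      ≡⟨ ℚof-suc (m + n) ⟩
  1ℚ +ℚ ℚof (m + n)        ≡⟨ cong (1ℚ +ℚ_) (ℚof-+ m n) ⟩
  1ℚ +ℚ (ℚof m +ℚ ℚof n)   ≡⟨ sym (+-assoc 1ℚ (ℚof m) (ℚof n)) ⟩
  (1ℚ +ℚ ℚof m) +ℚ ℚof n   ≡⟨ cong (_+ℚ ℚof n) (sym (ℚof-suc m)) ⟩
  ℚof (ℕ.suc m) +ℚ ℚof n   ∎
  where open ≡-Reasoning

ΣF : (n : ℕ) → (Fin n → ℚ) → ℚ
ΣF ℕ.zero    f = 0ℚ
ΣF (ℕ.suc n) f = f zero +ℚ ΣF n (λ i → f (suc i))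

ΣF-cong : ∀ n {f g : Fin n → ℚ} → (∀ i → f i ≡ g i) → ΣF n f ≡ ΣF n g
ΣF-cong ℕ.zero    f≡g = refl
ΣF-cong (ℕ.suc n) f≡g = cong₂ _+ℚ_ (f≡g zero) (ΣF-cong n (λ i → f≡g (suc i)))

ΣF-const : ∀ n q → ΣF n (λ _ → q) ≡ ℚof n *ℚ q
ΣF-const ℕ.zero    q = sym (*-zeroˡ q)
ΣF-const (ℕ.suc n) q = begin
  q +ℚ ΣF n (λ _ → q)    ≡⟨ cong (q +ℚ_) (ΣF-const n q) ⟩
  q +ℚ ℚof n *ℚ q        ≡⟨ solve 2 (λ q m → q :+ m :* q := (con 1ℚ :+ m) :* q) refl q (ℚof n) ⟩
  (1ℚ +ℚ ℚof n) *ℚ q     ≡⟨ cong (_*ℚ q) (sym (ℚof-suc n)) ⟩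
  ℚof (ℕ.suc n) *ℚ q     ∎
  where
  open ≡-Reasoning
  open +-*-Solver

ΣF-zero : ∀ n {f : Fin n → ℚ} → (∀ i → f i ≡ 0ℚ) → ΣF n f ≡ 0ℚ
ΣF-zero n {f} f≡0 = begin
  ΣF n f             ≡⟨ ΣF-cong n f≡0 ⟩
  ΣF n (λ _ → 0ℚ)    ≡⟨ ΣF-const n 0ℚ ⟩
  ℚof n *ℚ 0ℚ        ≡⟨ *-zeroʳ (ℚof n) ⟩
  0ℚ                 ∎
  where open ≡-Reasoning

ΣF-single : ∀ n (i : Fin n) (f : Fin n → ℚ) → (∀ j → i ≢ j → f j ≡ 0ℚ) → ΣF n f ≡ f i
ΣF-single (ℕ.suc n) zero f off = begin
  f zero +ℚ ΣF n (λ j → f (suc j))   ≡⟨ cong (f zero +ℚ_) (ΣF-zero n (λ j → off (suc j) (λ ()))) ⟩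
  f zero +ℚ 0ℚ                       ≡⟨ +-identityʳ (f zero) ⟩
  f zero                             ∎
  where open ≡-Reasoning
ΣF-single (ℕ.suc n) (suc i) f off = begin
  f zero +ℚ ΣF n (λ j → f (suc j))   ≡⟨ cong₂ _+ℚ_ (off zero (λ ())) rest ⟩
  0ℚ +ℚ f (suc i)                    ≡⟨ +-identityˡ (f (suc i)) ⟩
  f (suc i)                          ∎
  where
  open ≡-Reasoning
  rest : ΣF n (λ j → f (suc j)) ≡ f (suc i)
  rest = ΣF-single n i (λ j → f (suc j)) (λ j i≢j → off (suc j) (λ e → i≢j (suc-injective e)))

δ : ∀ {n} → Fin n → Fin n → ℚ → ℚ
δ i j q = if ⌊ i ≟F j ⌋ then q else 0ℚ

δ-diag : ∀ {n} (i : Fin n) q → δ i i q ≡ q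
δ-diag i q with i ≟F i
... | yes _  = refl
... | no i≢i = ⊥-elim (i≢i refl)

δ-off : ∀ {n} {i j : Fin n} q → i ≢ j → δ i j q ≡ 0ℚ
δ-off {i = i} {j} q i≢j with i ≟F j
... | yes i≡j = ⊥-elim (i≢j i≡j)
... | no _    = refl

δ-sym : ∀ {n} (i j : Fin n) q → δ i j q ≡ δ j i q
δ-sym i j q with i ≟F j | j ≟F i
... | yes _   | yes _   = refl
... | no _    | no _    = refl
... | yes i≡j | no j≢i  = ⊥-elim (j≢i (sym i≡j))
... | no i≢j  | yes j≡i = ⊥-elim (i≢j (sym j≡i))

δ-∧ : ∀ {m n} (i i' : Fin m) (k k' : Fin n) q →
  (if ⌊ i ≟F i' ⌋ ∧ ⌊ k ≟F k' ⌋ then q else 0ℚ) ≡ δ i i' (δ k k' q)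
δ-∧ i i' k k' q with i ≟F i'
... | yes _ = refl
... | no _  = refl

ΣF-δ : ∀ n (i : Fin n) x q → ΣF n (λ j → x *ℚ δ i j q) ≡ x *ℚ q
ΣF-δ n i x q = begin
  ΣF n (λ j → x *ℚ δ i j q)   ≡⟨ ΣF-single n i _ (λ j i≢j → trans (cong (x *ℚ_) (δ-off q i≢j)) (*-zeroʳ x)) ⟩
  x *ℚ δ i i q                ≡⟨ cong (x *ℚ_) (δ-diag i q) ⟩
  x *ℚ q                      ∎
  where open ≡-Reasoning

ΣF-δ-outer : ∀ m n (i : Fin m) x (h : Fin n → ℚ) →
  ΣF m (λ j → ΣF n (λ k → x *ℚ δ i j (h k))) ≡ ΣF n (λ k → x *ℚ h k)
ΣF-δ-outer m n i x h = begin
  ΣF m (λ j → ΣF n (λ k → x *ℚ δ i j (h k)))   ≡⟨ ΣF-single m i _ off ⟩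
  ΣF n (λ k → x *ℚ δ i i (h k))                ≡⟨ ΣF-cong n (λ k → cong (x *ℚ_) (δ-diag i (h k))) ⟩
  ΣF n (λ k → x *ℚ h k)                        ∎
  where
  open ≡-Reasoning
  off : ∀ j → i ≢ j → ΣF n (λ k → x *ℚ δ i j (h k)) ≡ 0ℚ
  off j i≢j = ΣF-zero n (λ k → trans (cong (x *ℚ_) (δ-off (h k) i≢j)) (*-zeroʳ x))

Σ-cong : ∀ {A : Set} (xs : List A) {f g : A → ℚ} → (∀ x → f x ≡ g x) → Σ xs f ≡ Σ xs g
Σ-cong []       f≡g = refl
Σ-cong (x ∷ xs) f≡g = cong₂ _+ℚ_ (f≡g x) (Σ-cong xs f≡g)

Σ-*ˡ : ∀ {A : Set} (xs : List A) k (f : A → ℚ) → Σ xs (λ x → k *ℚ f x) ≡ k *ℚ Σ xs f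
Σ-*ˡ []       k f = sym (*-zeroʳ k)
Σ-*ˡ (x ∷ xs) k f = trans (cong (k *ℚ f x +ℚ_) (Σ-*ˡ xs k f)) (sym (*-distribˡ-+ k (f x) _))

Σ-++ : ∀ {A : Set} (xs ys : List A) (f : A → ℚ) → Σ (xs ++ ys) f ≡ Σ xs f +ℚ Σ ys f
Σ-++ []       ys f = sym (+-identityˡ _)
Σ-++ (x ∷ xs) ys f = trans (cong (f x +ℚ_) (Σ-++ xs ys f)) (sym (+-assoc (f x) _ _))

Σ-map : ∀ {A B : Set} (g : A → B) (xs : List A) (f : B → ℚ) → Σ (map g xs) f ≡ Σ xs (λ x → f (g x))
Σ-map g []       f = refl
Σ-map g (x ∷ xs) f = cong (f (g x) +ℚ_) (Σ-map g xs f)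

Σ-concatMap : ∀ {A B : Set} (h : A → List B) (xs : List A) (f : B → ℚ) →
  Σ (concatMap h xs) f ≡ Σ xs (λ x → Σ (h x) f)
Σ-concatMap h []       f = refl
Σ-concatMap h (x ∷ xs) f =
  trans (Σ-++ (h x) (concatMap h xs) f) (cong (Σ (h x) f +ℚ_) (Σ-concatMap h xs f))

Σ-tabulate : ∀ {A : Set} n (g : Fin n → A) (f : A → ℚ) → Σ (tabulate g) f ≡ ΣF n (λ i → f (g i))
Σ-tabulate ℕ.zero    g f = refl
Σ-tabulate (ℕ.suc n) g f = cong (f (g zero) +ℚ_) (Σ-tabulate n (λ i → g (suc i)) f)

Σ-family : ∀ {B : Set} n (g : Fin n → B) (f : B → ℚ) → Σ (map g (allFin n)) f ≡ ΣF n (λ i → f (g i))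
Σ-family n g f = trans (Σ-map g (allFin n) f) (Σ-tabulate n (λ i → i) (λ i → f (g i)))

Σ-allComps : ∀ p r s (f : Comp p r s → ℚ) → Σ (allComps p r s) f ≡
  f L +ℚ (f Lx +ℚ (f Ly +ℚ (f Lz +ℚ
    (ΣF s (λ j → f (Lβ j)) +ℚ (ΣF r (λ i → f (Lα i)) +ℚ ΣF r (λ i → ΣF p (λ k → f (Lαj i k))))))))
Σ-allComps p r s f = cong (λ t → f L +ℚ (f Lx +ℚ (f Ly +ℚ (f Lz +ℚ t)))) (begin
  Σ (βs ++ (αs ++ αjs)) f                 ≡⟨ Σ-++ βs _ f ⟩
  Σ βs f +ℚ Σ (αs ++ αjs) f               ≡⟨ cong₂ _+ℚ_ (Σ-family s Lβ f) (Σ-++ αs αjs f) ⟩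
  ΣF s (λ j → f (Lβ j)) +ℚ (Σ αs f +ℚ Σ αjs f)
    ≡⟨ cong (ΣF s (λ j → f (Lβ j)) +ℚ_) (cong₂ _+ℚ_ (Σ-family r Lα f) sum-αjs) ⟩
  _                                       ∎)
  where
  open ≡-Reasoning
  βs = map Lβ (allFin s)
  αs = map Lα (allFin r)
  αjs = concatMap (λ i → map (Lαj i) (allFin p)) (allFin r)
  sum-αjs : Σ αjs f ≡ ΣF r (λ i → ΣF p (λ k → f (Lαj i k)))
  sum-αjs = begin
    Σ αjs f                                          ≡⟨ Σ-concatMap _ (allFin r) f ⟩
    Σ (allFin r) (λ i → Σ (map (Lαj i) (allFin p)) f) ≡⟨ Σ-tabulate r (λ i → i) _ ⟩
    ΣF r (λ i → Σ (map (Lαj i) (allFin p)) f)        ≡⟨ ΣF-cong r (λ i → Σ-family p (Lαj i) f) ⟩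
    ΣF r (λ i → ΣF p (λ k → f (Lαj i k)))            ∎

Σ-supportedOnΣ : ∀ {p r s} (D : Divisor p r s) → D L ≡ 0ℚ → D Lx ≡ 0ℚ → D Ly ≡ 0ℚ → D Lz ≡ 0ℚ →
  (h : Comp p r s → ℚ) → Σ (allComps p r s) (λ c → D c *ℚ h c) ≡
    ΣF s (λ j → D (Lβ j) *ℚ h (Lβ j)) +ℚ (ΣF r (λ i → D (Lα i) *ℚ h (Lα i))
      +ℚ ΣF r (λ i → ΣF p (λ k → D (Lαj i k) *ℚ h (Lαj i k))))
Σ-supportedOnΣ {p} {r} {s} D DL≡0 DLx≡0 DLy≡0 DLz≡0 h =
  trans (Σ-allComps p r s (λ c → D c *ℚ h c))
        (trans (drop DL≡0) (trans (drop DLx≡0) (trans (drop DLy≡0) (drop DLz≡0))))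
  where
  drop : ∀ {c} {t} → D c ≡ 0ℚ → D c *ℚ h c +ℚ t ≡ t
  drop {c} {t} Dc≡0 = trans (cong (λ x → x *ℚ h c +ℚ t) Dc≡0)
                            (trans (cong (_+ℚ t) (*-zeroˡ (h c))) (+-identityˡ t))

_∙_ : ∀ {p r s} → Divisor p r s → Comp p r s → ℚ
_∙_ {p} {r} {s} E C = Σ (allComps p r s) (λ C' → E C' *ℚ ι C C')

·-rows : ∀ {p r s} (D E : Divisor p r s) → D · E ≡ Σ (allComps p r s) (λ C → D C *ℚ (E ∙ C))
·-rows {p} {r} {s} D E = Σ-cong (allComps p r s) (λ C →
  trans (Σ-cong (allComps p r s) (λ C' → *-assoc (D C) (E C') (ι C C')))
        (Σ-*ˡ (allComps p r s) (D C) (λ C' → E C' *ℚ ι C C')))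

module IntersectionsOfVΣ (p r s : ℕ) .{{_ : NonZero p}} where

  c P w₁ w₂ : ℚ
  c = (+ (p ∸ 2)) /ℚ p
  P = ℚof p
  w₁ = - c
  w₂ = - (ℚof 2 *ℚ c)

  V : Divisor p r s
  V = VΣ p r s

  open +-*-Solver

  V∙Lβ : ∀ j → V ∙ Lβ j ≡ c *ℚ P
  V∙Lβ j = begin
    V ∙ Lβ j
      ≡⟨ Σ-supportedOnΣ V refl refl refl refl (ι (Lβ j)) ⟩
    ΣF s (λ j' → w₁ *ℚ δ j j' (- P)) +ℚ (ΣF r (λ _ → w₂ *ℚ 0ℚ) +ℚ ΣF r (λ _ → ΣF p (λ _ → w₁ *ℚ 0ℚ)))
      ≡⟨ cong₂ _+ℚ_ (ΣF-δ s j w₁ (- P))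
           (cong₂ _+ℚ_ (ΣF-zero r (λ _ → *-zeroʳ w₂)) (ΣF-zero r (λ _ → ΣF-zero p (λ _ → *-zeroʳ w₁)))) ⟩
    w₁ *ℚ (- P) +ℚ (0ℚ +ℚ 0ℚ)
      ≡⟨ solve 2 (λ c P → (:- c) :* (:- P) :+ (con 0ℚ :+ con 0ℚ) := c :* P) refl c P ⟩
    c *ℚ P ∎
    where open ≡-Reasoning

  V∙Lα : ∀ i → V ∙ Lα i ≡ c *ℚ P
  V∙Lα i = begin
    V ∙ Lα i
      ≡⟨ Σ-supportedOnΣ V refl refl refl refl (ι (Lα i)) ⟩
    ΣF s (λ _ → w₁ *ℚ 0ℚ) +ℚ (ΣF r (λ i' → w₂ *ℚ δ i i' (- P)) +ℚ ΣF r (λ i' → ΣF p (λ _ → w₁ *ℚ δ i i' 1ℚ)))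
      ≡⟨ cong₂ _+ℚ_ (ΣF-zero s (λ _ → *-zeroʳ w₁))
           (cong₂ _+ℚ_ (ΣF-δ r i w₂ (- P)) (trans (ΣF-δ-outer r p i w₁ (λ _ → 1ℚ)) (ΣF-const p (w₁ *ℚ 1ℚ)))) ⟩
    0ℚ +ℚ (w₂ *ℚ (- P) +ℚ P *ℚ (w₁ *ℚ 1ℚ))
      ≡⟨ solve 2 (λ c P → con 0ℚ :+ ((:- ((con 1ℚ :+ con 1ℚ) :* c)) :* (:- P) :+ P :* ((:- c) :* con 1ℚ)) := c :* P)
           refl c P ⟩
    c *ℚ P ∎
    where open ≡-Reasoning

  V∙Lαj : ∀ i k → V ∙ Lαj i k ≡ 0ℚ
  V∙Lαj i k = begin
    V ∙ Lαj i k
      ≡⟨ Σ-supportedOnΣ V refl refl refl refl (ι (Lαj i k)) ⟩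
    ΣF s (λ _ → w₁ *ℚ 0ℚ) +ℚ (ΣF r (λ i' → w₂ *ℚ δ i' i 1ℚ)
      +ℚ ΣF r (λ i' → ΣF p (λ k' → w₁ *ℚ (if ⌊ i ≟F i' ⌋ ∧ ⌊ k ≟F k' ⌋ then - ℚof 2 else 0ℚ))))
      ≡⟨ cong₂ _+ℚ_ (ΣF-zero s (λ _ → *-zeroʳ w₁)) (cong₂ _+ℚ_ sum-α sum-αj) ⟩
    0ℚ +ℚ (w₂ *ℚ 1ℚ +ℚ w₁ *ℚ (- ℚof 2))
      ≡⟨ solve 2 (λ c T → con 0ℚ :+ ((:- (T :* c)) :* con 1ℚ :+ (:- c) :* (:- T)) := con 0ℚ) refl c (ℚof 2) ⟩
    0ℚ ∎
    where
    open ≡-Reasoning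
    sum-α : ΣF r (λ i' → w₂ *ℚ δ i' i 1ℚ) ≡ w₂ *ℚ 1ℚ
    sum-α = trans (ΣF-cong r (λ i' → cong (w₂ *ℚ_) (δ-sym i' i 1ℚ))) (ΣF-δ r i w₂ 1ℚ)
    sum-αj : ΣF r (λ i' → ΣF p (λ k' → w₁ *ℚ (if ⌊ i ≟F i' ⌋ ∧ ⌊ k ≟F k' ⌋ then - ℚof 2 else 0ℚ)))
           ≡ w₁ *ℚ (- ℚof 2)
    sum-αj = begin
      _ ≡⟨ ΣF-cong r (λ i' → ΣF-cong p (λ k' → cong (w₁ *ℚ_) (δ-∧ i i' k k' (- ℚof 2)))) ⟩
      ΣF r (λ i' → ΣF p (λ k' → w₁ *ℚ δ i i' (δ k k' (- ℚof 2)))) ≡⟨ ΣF-δ-outer r p i w₁ _ ⟩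
      ΣF p (λ k' → w₁ *ℚ δ k k' (- ℚof 2))                        ≡⟨ ΣF-δ p k w₁ (- ℚof 2) ⟩
      w₁ *ℚ (- ℚof 2)                                             ∎

  V·V : V · V ≡ ℚof s *ℚ (w₁ *ℚ (c *ℚ P)) +ℚ (ℚof r *ℚ (w₂ *ℚ (c *ℚ P)) +ℚ 0ℚ)
  V·V = begin
    V · V
      ≡⟨ ·-rows V V ⟩
    Σ (allComps p r s) (λ C → V C *ℚ (V ∙ C))
      ≡⟨ Σ-supportedOnΣ V refl refl refl refl (V ∙_) ⟩
    ΣF s (λ j → w₁ *ℚ (V ∙ Lβ j)) +ℚ (ΣF r (λ i → w₂ *ℚ (V ∙ Lα i))
      +ℚ ΣF r (λ i → ΣF p (λ k → w₁ *ℚ (V ∙ Lαj i k))))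
      ≡⟨ cong₂ _+ℚ_ (trans (ΣF-cong s (λ j → cong (w₁ *ℚ_) (V∙Lβ j))) (ΣF-const s _))
           (cong₂ _+ℚ_ (trans (ΣF-cong r (λ i → cong (w₂ *ℚ_) (V∙Lα i))) (ΣF-const r _))
             (ΣF-zero r (λ i → ΣF-zero p (λ k → trans (cong (w₁ *ℚ_) (V∙Lαj i k)) (*-zeroʳ w₁))))) ⟩
    ℚof s *ℚ (w₁ *ℚ (c *ℚ P)) +ℚ (ℚof r *ℚ (w₂ *ℚ (c *ℚ P)) +ℚ 0ℚ) ∎
    where open ≡-Reasoning

ℚof-2r+s : ∀ r s → ℚof (2 * r + s) ≡ (ℚof r +ℚ ℚof r) +ℚ ℚof s
ℚof-2r+s r s = begin
  ℚof (2 * r + s)              ≡⟨ ℚof-+ (2 * r) s ⟩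
  ℚof (r + (r + 0)) +ℚ ℚof s   ≡⟨ cong (λ n → ℚof (r + n) +ℚ ℚof s) (ℕP.+-identityʳ r) ⟩
  ℚof (r + r) +ℚ ℚof s         ≡⟨ cong (_+ℚ ℚof s) (ℚof-+ r r) ⟩
  (ℚof r +ℚ ℚof r) +ℚ ℚof s    ∎
  where open ≡-Reasoning

mainTheorem6 : (p r s : ℕ) .{{_ : NonZero p}} → Prime p → 3 < p → 2 * r + s ≡ p ∸ 3 →
    VΣ p r s · VΣ p r s
      ≡ (ℚof (p ∸ 3) *ℚ (- ℚof p)) *ℚ (((+ (p ∸ 2)) /ℚ p) *ℚ ((+ (p ∸ 2)) /ℚ p))
mainTheorem6 p r s _ _ 2r+s≡p-3 = begin
  V · V
    ≡⟨ V·V ⟩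
  ℚof s *ℚ (w₁ *ℚ (c *ℚ P)) +ℚ (ℚof r *ℚ (w₂ *ℚ (c *ℚ P)) +ℚ 0ℚ)
    ≡⟨ solve 4 (λ c P R S →
         S :* ((:- c) :* (c :* P)) :+ (R :* ((:- ((con 1ℚ :+ con 1ℚ) :* c)) :* (c :* P)) :+ con 0ℚ)
         := (((R :+ R) :+ S) :* (:- P)) :* (c :* c)) refl c P (ℚof r) (ℚof s) ⟩
  (((ℚof r +ℚ ℚof r) +ℚ ℚof s) *ℚ (- P)) *ℚ (c *ℚ c)
    ≡⟨ cong (λ t → (t *ℚ (- P)) *ℚ (c *ℚ c)) (trans (sym (ℚof-2r+s r s)) (cong ℚof 2r+s≡p-3)) ⟩
  (ℚof (p ∸ 3) *ℚ (- P)) *ℚ (c *ℚ c) ∎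
  where
  open ≡-Reasoning
  open +-*-Solver
  open IntersectionsOfVΣ p r s
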